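{- Let $\Gamma$ be a minimal prime graph and let $U\subseteq V(\Gamma)$ be a generation site. Then there exists a proper 3-coloring of $\overline{\Gamma}$ in which the set $K=V(\Gamma)\setminus U$ is colored using at most 2 colors.
   Context: All graphs are finite, simple and undirected; $\overline{\Gamma}$ is the complement of $\Gamma$. A minimal prime graph is a connected graph $\Gamma$ on two or more vertices such that (1) $\overline{\Gamma}$ is triangle-free, (2) $\overline{\Gamma}$ is 3-colorable, and (3) for every edge $e$ of $\Gamma$, the complement of the graph obtained from $\Gamma$ by deleting $e$ is not both triangle-free and 3-colorable. For a minimal prime graph $\Gamma$, a subset $U\subseteq V(\Gamma)$ is a generation site if the graph $\Gamma'$ obtained from $\Gamma$ by adding a new vertex $w$ and edges $\{w,u\}$ for all $u\in U$ is a minimal prime graph. -}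

module Defs where

open import Data.Nat using (ℕ; suc; _≤_)
open import Data.Fin using (Fin; zero; suc; _≟_)
open import Data.Fin.Subset using (Subset; _∈_; _∉_)
open import Data.Bool using (Bool; true; false; if_then_else_; _∧_; _∨_)
open import Data.Vec using (lookup)
open import Data.Product using (Σ; ∃; _×_; _,_)
open import Data.Sum using (_⊎_)
open import Relation.Nullary using (¬_)
open import Relation.Nullary.Decidable using (⌊_⌋)
open import Relation.Binary.PropositionalEquality using (_≡_; _≢_; refl)

record SimpleGraph (n : ℕ) : Set where
  field
    E      : Fin n → Fin n → Bool
    sym    : ∀ i j → E i j ≡ E j i
    irrefl : ∀ i → E i i ≡ false
open SimpleGraph public

Adj : {n : ℕ} → (Fin n → Fin n → Bool) → Fin n → Fin n → Set
Adj E i j = E i j ≡ true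

CoAdj : {n : ℕ} → (Fin n → Fin n → Bool) → Fin n → Fin n → Set
CoAdj E i j = i ≢ j × E i j ≡ false

data Walk {n : ℕ} (E : Fin n → Fin n → Bool) : Fin n → Fin n → Set where
  here : ∀ {i} → Walk E i i
  step : ∀ {i j k} → Adj E i j → Walk E j k → Walk E i k

Connected : {n : ℕ} → (Fin n → Fin n → Bool) → Set
Connected E = ∀ i j → Walk E i j

CoTriangleFree : {n : ℕ} → (Fin n → Fin n → Bool) → Set
CoTriangleFree E =
  ∀ a b c → CoAdj E a b → CoAdj E b c → CoAdj E a c → Data.Empty.⊥
  where import Data.Empty

ProperCoColoring3 : {n : ℕ} → (Fin n → Fin n → Bool) → (Fin n → Fin 3) → Set
ProperCoColoring3 E col = ∀ i j → CoAdj E i j → col i ≢ col j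

CoThreeColorable : {n : ℕ} → (Fin n → Fin n → Bool) → Set
CoThreeColorable E = Σ (_ → Fin 3) λ col → ProperCoColoring3 E col

deleteEdge : {n : ℕ} → (Fin n → Fin n → Bool) → Fin n → Fin n → Fin n → Fin n → Bool
deleteEdge E u v i j =
  if (⌊ i ≟ u ⌋ ∧ ⌊ j ≟ v ⌋) ∨ (⌊ i ≟ v ⌋ ∧ ⌊ j ≟ u ⌋) then false else E i j

record MinimalPrime {n : ℕ} (G : SimpleGraph n) : Set where
  field
    twoVertices   : 2 ≤ n
    connected     : Connected (E G)
    coTriFree     : CoTriangleFree (E G)
    coColorable   : CoThreeColorable (E G)
    minimal       : ∀ u v → Adj (E G) u v →
                    ¬ (CoTriangleFree (deleteEdge (E G) u v)
                       × CoThreeColorable (deleteEdge (E G) u v))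

-- Adding a new vertex (index zero) adjacent exactly to the vertices of U.
extendE : {n : ℕ} → (Fin n → Fin n → Bool) → Subset n → Fin (suc n) → Fin (suc n) → Bool
extendE E U zero    zero    = false
extendE E U zero    (suc j) = lookup U j
extendE E U (suc i) zero    = lookup U i
extendE E U (suc i) (suc j) = E i j

extend : {n : ℕ} → SimpleGraph n → Subset n → SimpleGraph (suc n)
extend G U = record { E = extendE (E G) U ; sym = s ; irrefl = ir }
  where
    s : ∀ i j → extendE (E G) U i j ≡ extendE (E G) U j i
    s zero zero = refl
    s zero (suc j) = refl
    s (suc i) zero = refl
    s (suc i) (suc j) = SimpleGraph.sym G i j
    ir : ∀ i → extendE (E G) U i i ≡ false
    ir zero = refl
    ir (suc i) = SimpleGraph.irrefl G i

GenerationSite : {n : ℕ} → SimpleGraph n → Subset n → Set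
GenerationSite G U = MinimalPrime (extend G U)

-- Colour the complement of the extended graph Γ + w properly with three colours.
-- Every vertex of K is non-adjacent to w in Γ + w, hence adjacent to w in the
-- complement, so K avoids the colour of w; restricting the colouring to Γ gives
-- the claim.
module Submission where

open import Defs
open import Data.Nat using (ℕ)
open import Data.Bool using (Bool; false)
open import Data.Bool.Properties using (¬-not)
open import Data.Fin using (Fin; zero; suc)
open import Data.Fin.Patterns using (0F; 1F; 2F)
open import Data.Fin.Properties using (suc-injective)
open import Data.Fin.Subset using (Subset; _∉_)
open import Data.Vec using (lookup)
open import Data.Vec.Properties using (lookup⇒[]=)
open import Data.Product using (Σ; _×_; _,_)
open import Data.Sum using (_⊎_; inj₁; inj₂)
open import Function using (_∘_)
open import Relation.Nullary using (contradiction)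
open import Relation.Binary.PropositionalEquality using (_≡_; _≢_; refl)

lookup-∉ : ∀ {n} {U : Subset n} {v} → v ∉ U → lookup U v ≡ false
lookup-∉ {U = U} {v} v∉U = ¬-not (v∉U ∘ lookup⇒[]= v U)

otherTwoColours : (c : Fin 3) →
  Σ (Fin 3) λ a → Σ (Fin 3) λ b → ∀ x → c ≢ x → x ≡ a ⊎ x ≡ b
otherTwoColours 0F = 1F , 2F , λ
  { 0F c≢x → contradiction refl c≢x ; 1F _ → inj₁ refl ; 2F _ → inj₂ refl }
otherTwoColours 1F = 0F , 2F , λ
  { 0F _ → inj₁ refl ; 1F c≢x → contradiction refl c≢x ; 2F _ → inj₂ refl }
otherTwoColours 2F = 0F , 1F , λ
  { 0F _ → inj₁ refl ; 1F _ → inj₂ refl ; 2F c≢x → contradiction refl c≢x }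

module _ {n : ℕ} (E : Fin n → Fin n → Bool) (U : Subset n) where

  coAdj-extend : ∀ {i j} → CoAdj E i j → CoAdj (extendE E U) (suc i) (suc j)
  coAdj-extend (i≢j , i≁j) = i≢j ∘ suc-injective , i≁j

  coAdj-newVertex : ∀ {v} → v ∉ U → CoAdj (extendE E U) zero (suc v)
  coAdj-newVertex v∉U = (λ ()) , lookup-∉ v∉U

  properCoColoring3-restrict : ∀ {col} → ProperCoColoring3 (extendE E U) col →
                               ProperCoColoring3 E (col ∘ suc)
  properCoColoring3-restrict proper i j = proper (suc i) (suc j) ∘ coAdj-extend

mainTheorem17 : {n : ℕ} (G : SimpleGraph n) (U : Subset n) →
    MinimalPrime G → GenerationSite G U →
    Σ (Fin n → Fin 3) λ col → ProperCoColoring3 (E G) col ×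
      Σ (Fin 3) λ a → Σ (Fin 3) λ b → (∀ v → v ∉ U → col v ≡ a ⊎ col v ≡ b)
mainTheorem17 G U _ site =
  let (col , proper)     = MinimalPrime.coColorable site
      (a , b , otherTwo) = otherTwoColours (col zero)
  in col ∘ suc , properCoColoring3-restrict (E G) U proper , a , b ,
     λ v v∉U → otherTwo (col (suc v)) (proper zero (suc v) (coAdj-newVertex (E G) U v∉U))
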